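{- Let $D(x)=1-39x-117x^2+27x^3$ and define integer sequences by the formal power series expansions \[ \frac{4-24x+36x^2}{D(x)}=\sum_{n\ge0}a_nx^n,\ \frac{3-27x^2}{D(x)}=\sum_{n\ge0}b_nx^n,\ \frac{4-36x^2}{D(x)}=\sum_{n\ge0}c_nx^n, \] \[ \frac{2+60x+18x^2}{D(x)}=\sum_{n\ge0}d_nx^n,\ \frac{5-45x^2}{D(x)}=\sum_{n\ge0}e_nx^n. \] Then for all $n\ge0$, $a_n^4+b_n^4+c_n^4+d_n^4=e_n^4-\big(2\cdot(-3)^n\big)^4$. -}

module Defs where

open import Data.Nat using (ℕ; zero; suc)
open import Data.Integer using (ℤ; +_; -_; _+_; _-_; _*_; 0ℤ)
open import Data.List using (List; []; _∷_)

-- A polynomial is its list of integer coefficients [p₀, p₁, p₂, …].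
Poly : Set
Poly = List ℤ

coeff : Poly → ℕ → ℤ
coeff []       _       = 0ℤ
coeff (c ∷ cs) zero    = c
coeff (c ∷ cs) (suc n) = coeff cs n

-- Formal power series division N(x) / (1 + q(x)·x) where the denominator is
-- 1 + q₀x + q₁x² + …  (constant term 1, hence a unit in ℤ[[x]]).
-- The coefficients s of S = N/D are the unique solution of D·S = N, i.e.
--   s_n = N_n − Σ_{k=1}^{n} D_k s_{n−k}.
private
  -- Σ_{k≥1} D_k · s_{n−k}, given  q = [D₁, D₂, …]  and prev = [s_{n−1}, s_{n−2}, …, s₀]
  conv : Poly → List ℤ → ℤ
  conv []       _          = 0ℤ
  conv _        []         = 0ℤ
  conv (d ∷ ds) (s ∷ ss)   = d * s + conv ds ss

  hist : Poly → Poly → ℕ → List ℤ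
  hist N q zero    = coeff N 0 ∷ []
  hist N q (suc n) = let prev = hist N q n in (coeff N (suc n) - conv q prev) ∷ prev

  headZ : List ℤ → ℤ
  headZ []      = 0ℤ
  headZ (x ∷ _) = x

seriesCoeff : (N q : Poly) → ℕ → ℤ
seriesCoeff N q n = headZ (hist N q n)

Dtail : Poly
Dtail = - (+ 39) ∷ - (+ 117) ∷ + 27 ∷ []

a b c d e : ℕ → ℤ
a = seriesCoeff (+ 4 ∷ - (+ 24) ∷ + 36 ∷ []) Dtail
b = seriesCoeff (+ 3 ∷ + 0 ∷ - (+ 27) ∷ []) Dtail
c = seriesCoeff (+ 4 ∷ + 0 ∷ - (+ 36) ∷ []) Dtail
d = seriesCoeff (+ 2 ∷ + 60 ∷ + 18 ∷ []) Dtail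
e = seriesCoeff (+ 5 ∷ + 0 ∷ - (+ 45) ∷ []) Dtail

-- Every sequence here satisfies s(n+3) = 39 s(n+2) + 117 s(n+1) − 27 s(n), so its n-th term is
-- a fixed linear form in the coordinates (xₙ, yₙ, zₙ) expressing the n-th term of any solution
-- through its first three terms. The quadratic form Q = xy + 36xz + 9yz is multiplied by 9 at
-- each step (9 = (−3)² is also the product of the two other roots 21 ± 12√3 of the characteristic
-- polynomial) and vanishes at n = 0, so the coordinates stay on the conic Q = 0; the theorem is a
-- quartic polynomial identity that holds modulo Q.
module Submission where

open import Defs
open import Data.Nat using (ℕ; zero; suc)
open import Data.Integer using (ℤ; +_; -_; _+_; _-_; _*_; _^_; 0ℤ; 1ℤ)
open import Data.Integer.Properties using (+-identityʳ)
open import Data.Integer.Tactic.RingSolver using (solve-∀)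
open import Data.List using ([]; _∷_)
open import Data.Product using (_×_; _,_; proj₁)
open import Relation.Binary.PropositionalEquality
  using (_≡_; refl; sym; trans; cong; cong₂; module ≡-Reasoning)
open ≡-Reasoning

Recurrent : (ℕ → ℤ) → Set
Recurrent s = ∀ n → s (suc (suc (suc n))) ≡ + 39 * s (suc (suc n)) + + 117 * s (suc n) - + 27 * s n

recurrent-unique : ∀ {s t} → Recurrent s → Recurrent t →
                   s 0 ≡ t 0 → s 1 ≡ t 1 → s 2 ≡ t 2 → ∀ n → s n ≡ t n
recurrent-unique {s} {t} rs rt e₀ e₁ e₂ n = proj₁ (agree n)
  where
  agree : ∀ n → s n ≡ t n × s (suc n) ≡ t (suc n) × s (suc (suc n)) ≡ t (suc (suc n))
  agree zero    = e₀ , e₁ , e₂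
  agree (suc n) with agree n
  ... | p , q , r = q , r , trans (rs n) (trans
          (cong₂ (λ u v → u - + 27 * v) (cong₂ (λ u v → + 39 * u + + 117 * v) r q) p)
          (sym (rt n)))

ℤ³ : Set
ℤ³ = ℤ × ℤ × ℤ

_·_ : ℤ³ → ℤ³ → ℤ
(u₀ , u₁ , u₂) · (x , y , z) = u₀ * x + u₁ * y + u₂ * z

initial : (ℕ → ℤ) → ℤ³
initial s = s 0 , s 1 , s 2

shift : ℤ³ → ℤ³
shift (s₀ , s₁ , s₂) = s₁ , s₂ , + 39 * s₂ + + 117 * s₁ - + 27 * s₀

shiftᵀ : ℤ³ → ℤ³
shiftᵀ (x , y , z) = - (+ 27) * z , x + + 117 * z , y + + 39 * z

·-shiftᵀ : ∀ u v → u · shiftᵀ v ≡ shift u · v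
·-shiftᵀ (u₀ , u₁ , u₂) (x , y , z) = expanded u₀ u₁ u₂ x y z
  where
  expanded : ∀ u₀ u₁ u₂ x y z →
    u₀ * (- (+ 27) * z) + u₁ * (x + + 117 * z) + u₂ * (y + + 39 * z)
      ≡ u₁ * x + u₂ * y + (+ 39 * u₂ + + 117 * u₁ - + 27 * u₀) * z
  expanded = solve-∀

window : ℤ³ → ℕ → ℤ³
window u zero    = u
window u (suc n) = shift (window u n)

solution : ℤ³ → ℕ → ℤ
solution u n = proj₁ (window u n)

solution-recurrent : ∀ u → Recurrent (solution u)
solution-recurrent u n = refl

window-shift : ∀ u n → window (shift u) n ≡ shift (window u n)
window-shift u zero    = refl
window-shift u (suc n) = cong shift (window-shift u n)

coords : ℕ → ℤ³
coords zero    = 1ℤ , 0ℤ , 0ℤ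
coords (suc n) = shiftᵀ (coords n)

solution-coords : ∀ u n → solution u n ≡ u · coords n
solution-coords (u₀ , u₁ , u₂) zero = read-first u₀ u₁ u₂
  where
  read-first : ∀ u₀ u₁ u₂ → u₀ ≡ u₀ * 1ℤ + u₁ * 0ℤ + u₂ * 0ℤ
  read-first = solve-∀
solution-coords u (suc n) = begin
  proj₁ (shift (window u n))  ≡⟨ cong proj₁ (window-shift u n) ⟨
  solution (shift u) n        ≡⟨ solution-coords (shift u) n ⟩
  shift u · coords n          ≡⟨ ·-shiftᵀ u (coords n) ⟨
  u · coords (suc n)          ∎

recurrent-coords : ∀ s → Recurrent s → ∀ n → s n ≡ initial s · coords n
recurrent-coords s rs n =
  trans (recurrent-unique {s} {solution (initial s)}
                          rs (solution-recurrent (initial s)) refl refl refl n)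
        (solution-coords (initial s) n)

series-recurrent : ∀ N → (∀ n → coeff N (suc (suc (suc n))) ≡ 0ℤ) → Recurrent (seriesCoeff N Dtail)
series-recurrent N high-zero n = begin
  s (suc (suc (suc n)))                      ≡⟨ unfold n ⟩
  coeff N (suc (suc (suc n))) - feedback n   ≡⟨ cong (_- feedback n) (high-zero n) ⟩
  0ℤ - feedback n                            ≡⟨ rearrange (s (suc (suc n))) (s (suc n)) (s n) ⟩
  + 39 * s (suc (suc n)) + + 117 * s (suc n) - + 27 * s n ∎
  where
  s : ℕ → ℤ
  s = seriesCoeff N Dtail

  feedback : ℕ → ℤ
  feedback n = - (+ 39) * s (suc (suc n)) + (- (+ 117) * s (suc n) + (+ 27 * s n + 0ℤ))

  unfold : ∀ n → s (suc (suc (suc n))) ≡ coeff N (suc (suc (suc n))) - feedback n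
  unfold zero    = refl
  unfold (suc n) = refl

  rearrange : ∀ p q r → 0ℤ - (- (+ 39) * p + (- (+ 117) * q + (+ 27 * r + 0ℤ)))
                      ≡ + 39 * p + + 117 * q - + 27 * r
  rearrange = solve-∀

powers-recurrent : ∀ r → r ^ 3 ≡ + 39 * r ^ 2 + + 117 * r ^ 1 - + 27 → Recurrent (r ^_)
powers-recurrent r root n = begin
  r * (r * (r * r ^ n))                                  ≡⟨ factor r (r ^ n) ⟩
  r ^ 3 * r ^ n                                          ≡⟨ cong (_* r ^ n) root ⟩
  (+ 39 * r ^ 2 + + 117 * r ^ 1 - + 27) * r ^ n          ≡⟨ expand r (r ^ n) ⟩
  + 39 * (r * (r * r ^ n)) + + 117 * (r * r ^ n) - + 27 * r ^ n ∎
  where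
  factor : ∀ r u → r * (r * (r * u)) ≡ r * (r * (r * 1ℤ)) * u
  factor = solve-∀

  expand : ∀ r u → (+ 39 * (r * (r * 1ℤ)) + + 117 * (r * 1ℤ) - + 27) * u
                 ≡ + 39 * (r * (r * u)) + + 117 * (r * u) - + 27 * u
  expand = solve-∀

conic : ℤ³ → ℤ
conic (x , y , z) = x * y + + 36 * x * z + + 9 * y * z

conic-shiftᵀ : ∀ v → conic (shiftᵀ v) ≡ + 9 * conic v
conic-shiftᵀ (x , y , z) = expanded x y z
  where
  expanded : ∀ x y z →
    (- (+ 27) * z) * (x + + 117 * z) + + 36 * (- (+ 27) * z) * (y + + 39 * z)
      + + 9 * (x + + 117 * z) * (y + + 39 * z)
      ≡ + 9 * (x * y + + 36 * x * z + + 9 * y * z)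
  expanded = solve-∀

coords-on-conic : ∀ n → conic (coords n) ≡ 0ℤ
coords-on-conic zero    = refl
coords-on-conic (suc n) = trans (conic-shiftᵀ (coords n)) (cong (+ 9 *_) (coords-on-conic n))

≡-mod-vanishing : ∀ {u v q r : ℤ} → u ≡ v + q * r → q ≡ 0ℤ → u ≡ v
≡-mod-vanishing {v = v} eq refl = trans eq (+-identityʳ v)

-- Fourth powers are spelled out because the ring solver does not recognise Data.Integer._^_;
-- u ⁴ is definitionally u ^ 4.
quartic-identity : ∀ x y z →
  let A = + 4 * x + + 132 * y + + 5652 * z
      B = + 3 * x + + 117 * y + + 4887 * z
      C = + 4 * x + + 156 * y + + 6516 * z
      D = + 2 * x + + 138 * y + + 5634 * z
      E = + 5 * x + + 195 * y + + 8145 * z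
      W = + 1 * x + - (+ 3) * y + + 9 * z
      Q = x * y + + 36 * x * z + + 9 * y * z
      R = - (+ 6912) * x * x - + 497664 * x * y - + 21026304 * x * z
          - + 10513152 * y * y - + 877879296 * y * z - + 18341966592 * z * z
      _⁴ : ℤ → ℤ
      u ⁴ = u * (u * (u * (u * 1ℤ)))
  in A ⁴ + B ⁴ + C ⁴ + D ⁴ ≡ E ⁴ - (+ 2 * W) ⁴ + Q * R
quartic-identity = solve-∀

quartic-on-conic : ∀ {A B C D E W} v →
  A ≡ initial a · v → B ≡ initial b · v → C ≡ initial c · v → D ≡ initial d · v →
  E ≡ initial e · v → W ≡ initial ((- (+ 3)) ^_) · v → conic v ≡ 0ℤ →
  A ^ 4 + B ^ 4 + C ^ 4 + D ^ 4 ≡ E ^ 4 - (+ 2 * W) ^ 4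
quartic-on-conic (x , y , z) refl refl refl refl refl refl =
  ≡-mod-vanishing (quartic-identity x y z)

a-recurrent : Recurrent a
a-recurrent = series-recurrent (+ 4 ∷ - (+ 24) ∷ + 36 ∷ []) (λ _ → refl)

b-recurrent : Recurrent b
b-recurrent = series-recurrent (+ 3 ∷ + 0 ∷ - (+ 27) ∷ []) (λ _ → refl)

c-recurrent : Recurrent c
c-recurrent = series-recurrent (+ 4 ∷ + 0 ∷ - (+ 36) ∷ []) (λ _ → refl)

d-recurrent : Recurrent d
d-recurrent = series-recurrent (+ 2 ∷ + 60 ∷ + 18 ∷ []) (λ _ → refl)

e-recurrent : Recurrent e
e-recurrent = series-recurrent (+ 5 ∷ + 0 ∷ - (+ 45) ∷ []) (λ _ → refl)

[−3]ⁿ-recurrent : Recurrent ((- (+ 3)) ^_)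
[−3]ⁿ-recurrent = powers-recurrent (- (+ 3)) refl

theorem2p9 : ∀ (n : ℕ) → a n ^ 4 + b n ^ 4 + c n ^ 4 + d n ^ 4 ≡ e n ^ 4 - ((+ 2) * (- (+ 3)) ^ n) ^ 4
theorem2p9 n = quartic-on-conic (coords n)
  (recurrent-coords a a-recurrent n) (recurrent-coords b b-recurrent n)
  (recurrent-coords c c-recurrent n) (recurrent-coords d d-recurrent n)
  (recurrent-coords e e-recurrent n) (recurrent-coords ((- (+ 3)) ^_) [−3]ⁿ-recurrent n)
  (coords-on-conic n)
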